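{- (a) $c_b(K_n)=1$ for all $n\ge 1$. (b) $c_b(C_n)=1$ for all $n\ge 3$. (c) For the path $P_n$ on $n$ vertices, $c_b(P_n)=1$ if $n\le 5$ and $c_b(P_n)=2$ if $n\ge 6$.
   Context: Bridge-burning Cops and Robbers is played on a finite graph $G$ by a team of cops and a single robber, with full information. First each cop chooses a starting vertex (several cops may share a vertex), then the robber chooses a starting vertex. The game then proceeds in rounds; in each round, first every cop either stays put or moves along an edge of the current graph to an adjacent vertex, and then the robber either stays put or moves along an edge of the current graph to an adjacent vertex. Every edge traversed by the robber is immediately deleted from the graph (the robber must delete every edge he traverses; cop moves delete nothing). The cops win if at some moment some cop occupies the same vertex as the robber; the robber wins if he avoids this forever. The bridge-burning cop number $c_b(G)$ is the minimum number of cops for which the cops have a winning strategy. $K_n$, $C_n$, $P_n$ denote the complete graph, cycle and path on $n$ vertices. -}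

module Defs where

open import Data.Nat using (ℕ; zero; suc; _<_)
import Data.Nat as ℕ
open import Data.Fin using (Fin; toℕ)
import Data.Fin as F
open import Data.Bool using (Bool; true; false; not; _∧_; _∨_; if_then_else_)
open import Data.Product using (Σ; ∃; _×_; _,_)
open import Data.Sum using (_⊎_)
open import Relation.Nullary using (¬_)
open import Relation.Nullary.Decidable using (⌊_⌋)
open import Relation.Binary.PropositionalEquality using (_≡_)

-- The current edge set of a (simple, undirected) graph on vertex set Fin n,
-- given as an adjacency predicate: E x y ≡ true iff xy is an edge.
Edges : ℕ → Set
Edges n = Fin n → Fin n → Bool

deleteEdge : ∀ {n} → Edges n → Fin n → Fin n → Edges n
deleteEdge E u v x y =
  if (⌊ x F.≟ u ⌋ ∧ ⌊ y F.≟ v ⌋) ∨ (⌊ x F.≟ v ⌋ ∧ ⌊ y F.≟ u ⌋)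
  then false else E x y

-- Positions of k cops (several cops may share a vertex)
Cops : ℕ → ℕ → Set
Cops n k = Fin k → Fin n

-- A single cop's move: stay, or move along an edge (deletes nothing)
CopStep : ∀ {n} → Edges n → Fin n → Fin n → Set
CopStep E u v = (u ≡ v) ⊎ (E u v ≡ true)

data RobberStep {n : ℕ} (E : Edges n) (r : Fin n) : Fin n → Edges n → Set where
  stay : RobberStep E r r E
  go   : (r' : Fin n) → E r r' ≡ true → RobberStep E r r' (deleteEdge E r r')

Caught : ∀ {n k} → Cops n k → Fin n → Set
Caught {k = k} cs r = ∃ λ (i : Fin k) → cs i ≡ r

-- CopsWin E cs r : with current graph E, cops at cs, robber at r and the
-- cops to move, the cops can force capture (in finitely many rounds).
-- This is the inductive (attractor) characterisation of the cops having a
-- winning strategy in this reachability game.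
data CopsWin {n k : ℕ} (E : Edges n) (cs : Cops n k) (r : Fin n) : Set where
  caught : Caught cs r → CopsWin E cs r
  move   : (cs' : Cops n k) →
           (∀ i → CopStep E (cs i) (cs' i)) →
           (Caught cs' r ⊎
             (∀ r' E' → RobberStep E r r' E' → CopsWin E' cs' r')) →
           CopsWin E cs r

KCopsWin : ∀ {n} → Edges n → ℕ → Set
KCopsWin {n} G k = Σ (Cops n k) λ cs → ∀ r → CopsWin G cs r

BridgeBurningCopNumber : ∀ {n} → Edges n → ℕ → Set
BridgeBurningCopNumber G m = KCopsWin G m × (∀ k → k < m → ¬ KCopsWin G k)

complete : (n : ℕ) → Edges n
complete n x y = not ⌊ x F.≟ y ⌋

path : (n : ℕ) → Edges n
path n x y = ⌊ suc (toℕ x) ℕ.≟ toℕ y ⌋ ∨ ⌊ suc (toℕ y) ℕ.≟ toℕ x ⌋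

-- cycle 0 - 1 - ... - (n-1) - 0   (a cycle for n ≥ 3)
cycle : (n : ℕ) → Edges n
cycle n x y = path n x y
  ∨ (⌊ toℕ x ℕ.≟ 0 ⌋ ∧ ⌊ suc (toℕ y) ℕ.≟ n ⌋)
  ∨ (⌊ toℕ y ℕ.≟ 0 ⌋ ∧ ⌊ suc (toℕ x) ℕ.≟ n ⌋)

module Submission where

-- With no cops the robber simply stays put.  On a path with
-- at least six vertices a single cop loses: levelling the path from the
-- cop's side, the robber waits two levels above the cop and, when the cop
-- comes next to him, steps one level up, burning the only edge between the
-- two halves ('hold-lose', a consequence of 'confined-lose').
--
-- Upper bounds rest on one pursuit lemma ('chase'): if the robber sits at the
-- dead end of a corridor whose other end holds a cop, the cop walks along it
-- and wins, since every robber move either stays inside the shrinking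
-- corridor or burns the edge behind him and ends in a shorter corridor.  On a
-- cycle, and on a path guarded at its last vertex by a second cop, one cop
-- walks towards the robber ('approach'); the first robber move burns an
-- edge and leaves him at the dead end of such a corridor.  On K_n every
-- robber position is next to the cop, and paths with at most five vertices
-- are settled by inspection ('capture-adjacent', 'capture-leaf').

open import Defs
open import Data.Nat using (ℕ; zero; suc; _+_; _∸_; _≤_; _<_; z≤n; s≤s; _≤?_)
import Data.Nat as ℕ
open import Data.Nat.Properties
open import Data.Fin using (Fin; toℕ; #_)
import Data.Fin as F
import Data.Fin.Properties as FP
open import Data.Bool using (true; false; _∧_; _∨_)
open import Data.Bool.Properties using (∨-zeroʳ)
open import Data.Product using (Σ-syntax; _×_; _,_)
import Data.Product as Product
open import Data.Sum using (_⊎_; inj₁; inj₂)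
import Data.Sum as Sum
open import Data.Empty using (⊥; ⊥-elim)
open import Relation.Nullary using (¬_; yes; no)
open import Relation.Nullary.Decidable using (⌊_⌋)
open import Relation.Binary.PropositionalEquality

false≢true : false ≢ true
false≢true ()

∨-true : ∀ a {b} → a ∨ b ≡ true → a ≡ true ⊎ b ≡ true
∨-true true  _ = inj₁ refl
∨-true false h = inj₂ h

∨-trueˡ : ∀ {a} b → a ≡ true → a ∨ b ≡ true
∨-trueˡ b refl = refl

∨-trueʳ : ∀ a {b} → b ≡ true → a ∨ b ≡ true
∨-trueʳ a refl = ∨-zeroʳ a

∧-true : ∀ a {b} → a ∧ b ≡ true → a ≡ true × b ≡ true
∧-true true h = refl , h

∧-intro : ∀ {a b} → a ≡ true → b ≡ true → a ∧ b ≡ true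
∧-intro refl refl = refl

≟-sound : ∀ {m n} → ⌊ m ℕ.≟ n ⌋ ≡ true → m ≡ n
≟-sound {m} {n} h with m ℕ.≟ n
... | yes e = e
... | no _  = ⊥-elim (false≢true h)

≟-complete : ∀ {m n} → m ≡ n → ⌊ m ℕ.≟ n ⌋ ≡ true
≟-complete e = cong ⌊_⌋ (≟-diag e)

fin-≟-refl : ∀ {n} (x : Fin n) → ⌊ x F.≟ x ⌋ ≡ true
fin-≟-refl x = cong ⌊_⌋ (≡-≟-identity F._≟_ (refl {x = x}))

deleteEdge-⊆ : ∀ {n} (E : Edges n) u v {x y} →
               deleteEdge E u v x y ≡ true → E x y ≡ true
deleteEdge-⊆ E u v {x} {y} h
  with (⌊ x F.≟ u ⌋ ∧ ⌊ y F.≟ v ⌋) ∨ (⌊ x F.≟ v ⌋ ∧ ⌊ y F.≟ u ⌋)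
... | true  = ⊥-elim (false≢true h)
... | false = h

deleteEdge-keeps : ∀ {n} (E : Edges n) u v {x y} → x ≢ u → x ≢ v →
                   deleteEdge E u v x y ≡ E x y
deleteEdge-keeps E u v {x} x≢u x≢v with x F.≟ u | x F.≟ v
... | yes e | _     = ⊥-elim (x≢u e)
... | no _  | yes e = ⊥-elim (x≢v e)
... | no _  | no _  = refl

deleteEdge-removes : ∀ {n} (E : Edges n) u v → deleteEdge E u v u v ≡ false
deleteEdge-removes E u v rewrite fin-≟-refl u | fin-≟-refl v = refl

deleteEdge-removes′ : ∀ {n} (E : Edges n) u v → deleteEdge E u v v u ≡ false
deleteEdge-removes′ E u v
  rewrite fin-≟-refl u | fin-≟-refl v | ∨-zeroʳ (⌊ v F.≟ u ⌋ ∧ ⌊ u F.≟ v ⌋) = refl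

moveCop : ∀ {n k} → Cops n k → Fin k → Fin n → Cops n k
moveCop cs p v i with i F.≟ p
... | yes _ = v
... | no _  = cs i

moveCop-moved : ∀ {n k} (cs : Cops n k) p v → moveCop cs p v p ≡ v
moveCop-moved cs p v with p F.≟ p
... | yes _   = refl
... | no p≢p  = ⊥-elim (p≢p refl)

moveCop-legal : ∀ {n k} (E : Edges n) (cs : Cops n k) p v → E (cs p) v ≡ true →
                ∀ i → CopStep E (cs i) (moveCop cs p v i)
moveCop-legal E cs p v h i with i F.≟ p
... | yes refl = inj₂ h
... | no _     = inj₁ refl

-- Without cops the robber wins by never moving.
noCops-lose : ∀ {n} (E : Edges n) (cs : Cops n 0) r → ¬ CopsWin E cs r
noCops-lose E cs r (caught (() , _))
noCops-lose E cs r (move cs′ _ (inj₁ (() , _)))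
noCops-lose E cs r (move cs′ _ (inj₂ next)) = noCops-lose E cs′ r (next r E stay)

capture-adjacent : ∀ {n k} (E : Edges n) (cs : Cops n k) p r →
                   E (cs p) r ≡ true → CopsWin E cs r
capture-adjacent E cs p r h =
  move (moveCop cs p r) (moveCop-legal E cs p r h) (inj₁ (p , moveCop-moved cs p r))

-- A robber on a leaf with neighbour w is caught by a cop adjacent to w: the
-- cop steps onto w, after which the robber can neither stay nor leave.
capture-leaf : ∀ {n k} (E : Edges n) (cs : Cops n k) p r w →
               E (cs p) w ≡ true → E w r ≡ true → (∀ y → E r y ≡ true → y ≡ w) →
               CopsWin E cs r
capture-leaf E cs p r w cw wr leaf =
  move cs′ (moveCop-legal E cs p w cw) (inj₂ robber)
  where
  cs′ : Cops _ _
  cs′ = moveCop cs p w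
  robber : ∀ r′ E′ → RobberStep E r r′ E′ → CopsWin E′ cs′ r′
  robber _ _ stay = capture-adjacent E cs′ p r
                      (subst (λ x → E x r ≡ true) (sym (moveCop-moved cs p w)) wr)
  robber r′ _ (go _ h) = caught (p , trans (moveCop-moved cs p w) (sym (leaf r′ h)))

record Corridor {n} (E : Edges n) (ℓ : ℕ → Fin n) (m : ℕ) : Set where
  field
    linked   : ∀ i → i < m → E (ℓ i) (ℓ (suc i)) ≡ true
    distinct : ∀ i j → i ≤ m → j ≤ m → ℓ i ≡ ℓ j → i ≡ j
    confined : ∀ i y → i < m → E (ℓ (suc i)) y ≡ true →
               y ≡ ℓ i ⊎ (suc i < m × y ≡ ℓ (suc (suc i)))

corridor-tail : ∀ {n} {E : Edges n} {ℓ m} →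
                Corridor E ℓ (suc m) → Corridor E (λ i → ℓ (suc i)) m
corridor-tail c = record
  { linked   = λ i i<m → linked (suc i) (s≤s i<m)
  ; distinct = λ i j i≤m j≤m e →
                 suc-injective (distinct (suc i) (suc j) (s≤s i≤m) (s≤s j≤m) e)
  ; confined = λ i y i<m h →
                 Sum.map₂ (Product.map₁ ≤-pred) (confined (suc i) y (s≤s i<m) h)
  }
  where open Corridor c

-- If the robber steps back from the dead end, burning the last edge, the
-- shortened corridor ends in a dead end again.
corridor-retreat : ∀ {n} {E : Edges n} {ℓ m} → Corridor E ℓ (suc (suc m)) →
                   Corridor (deleteEdge E (ℓ (suc (suc m))) (ℓ (suc m)))
                            (λ i → ℓ (suc i)) m
corridor-retreat {E = E} {ℓ} {m} c = record
  { linked   = linked′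
  ; distinct = λ i j i≤m j≤m e → suc-injective
                 (distinct (suc i) (suc j) (s≤s (m≤n⇒m≤1+n i≤m)) (s≤s (m≤n⇒m≤1+n j≤m)) e)
  ; confined = confined′
  }
  where
  open Corridor c
  u v : Fin _
  u = ℓ (suc (suc m))
  v = ℓ (suc m)
  apart : ∀ i j → i ≤ suc (suc m) → j ≤ suc (suc m) → i < j → ℓ i ≢ ℓ j
  apart i j i≤ j≤ i<j e = <-irrefl (distinct i j i≤ j≤ e) i<j
  linked′ : ∀ i → i < m → deleteEdge E u v (ℓ (suc i)) (ℓ (suc (suc i))) ≡ true
  linked′ i i<m =
    trans (deleteEdge-keeps E u v
             (apart (suc i) (suc (suc m)) (m≤n⇒m≤1+n i<m′) ≤-refl (s≤s i<m′))
             (apart (suc i) (suc m) (m≤n⇒m≤1+n i<m′) (n≤1+n _) (s≤s i<m)))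
          (linked (suc i) (s≤s (m≤n⇒m≤1+n i<m)))
    where
    i<m′ : i < suc m
    i<m′ = m≤n⇒m≤1+n i<m
  confined′ : ∀ i y → i < m → deleteEdge E u v (ℓ (suc (suc i))) y ≡ true →
              y ≡ ℓ (suc i) ⊎ (suc i < m × y ≡ ℓ (suc (suc (suc i))))
  confined′ i y i<m h with confined (suc i) y (s≤s (m≤n⇒m≤1+n i<m)) (deleteEdge-⊆ E u v h)
  ... | inj₁ e = inj₁ e
  ... | inj₂ (_ , e) with suc i <? m
  ...   | yes si<m = inj₂ (si<m , e)
  ...   | no si≮m with ≤-antisym i<m (≮⇒≥ si≮m)
  ...     | refl = ⊥-elim (false≢true
                      (trans (sym (deleteEdge-removes′ E u v)) (subst (λ z → deleteEdge E u v v z ≡ true) e h)))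

first-step : ∀ {n k m} {ℓ : ℕ → Fin n} {E : Edges n} (cs : Cops n k) p →
             cs p ≡ ℓ 0 → Corridor E ℓ (suc m) → E (cs p) (ℓ 1) ≡ true
first-step {ℓ = ℓ} {E} cs p cp c =
  subst (λ x → E x (ℓ 1) ≡ true) (sym cp) (Corridor.linked c 0 (s≤s z≤n))

-- The pursuit lemma: a cop at the open end of a corridor catches a robber at
-- its dead end by walking along it.  'chase-reply' covers the robber's reply
-- once the cop has reached ℓ 1: staying leaves him at the end of the tail,
-- and the only move available burns the last edge of the corridor.
chase : ∀ {n k} m {ℓ : ℕ → Fin n} {E : Edges n} (cs : Cops n k) p →
        cs p ≡ ℓ 0 → Corridor E ℓ m → CopsWin E cs (ℓ m)
chase-reply : ∀ {n k} m {ℓ : ℕ → Fin n} {E : Edges n} (cs : Cops n k) p → 0 < m →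
              cs p ≡ ℓ 1 → Corridor E ℓ (suc m) →
              ∀ r′ E′ → RobberStep E (ℓ (suc m)) r′ E′ → CopsWin E′ cs r′

chase zero cs p cp _ = caught (p , cp)
chase (suc zero) {ℓ} {E} cs p cp c =
  capture-adjacent E cs p (ℓ 1) (first-step cs p cp c)
chase (suc (suc m)) {ℓ} {E} cs p cp c =
  move cs′ (moveCop-legal E cs p (ℓ 1) (first-step cs p cp c))
       (inj₂ (chase-reply (suc m) cs′ p (s≤s z≤n) (moveCop-moved cs p (ℓ 1)) c))
  where
  cs′ : Cops _ _
  cs′ = moveCop cs p (ℓ 1)

chase-reply zero cs p ()
chase-reply (suc m) cs p _ cp c _ _ stay = chase (suc m) cs p cp (corridor-tail c)
chase-reply (suc m) cs p _ cp c r′ _ (go _ h) with Corridor.confined c (suc m) r′ ≤-refl h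
... | inj₁ refl      = chase m cs p cp (corridor-retreat c)
... | inj₂ (m<m , _) = ⊥-elim (<-irrefl refl m<m)

-- D d cs says the cops at cs
-- are d moves away from capturing the robber at r in the untouched graph G:
-- at distance 0 he is caught, from distance d + 1 the cops can reach
-- distance d, and if the robber ever leaves r (burning the edge) while the
-- cops are at positive distance, they win from there.
approach : ∀ {n k} (G : Edges n) (r : Fin n) (D : ℕ → Cops n k → Set) →
           (∀ cs → D 0 cs → Caught cs r) →
           (∀ d cs → D (suc d) cs →
              Σ[ cs′ ∈ Cops n k ] (∀ i → CopStep G (cs i) (cs′ i)) × D d cs′) →
           (∀ d cs → D (suc d) cs → ∀ r′ → G r r′ ≡ true →
              CopsWin (deleteEdge G r r′) cs r′) →
           ∀ d cs → D d cs → CopsWin G cs r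
approach-reply : ∀ {n k} (G : Edges n) (r : Fin n) (D : ℕ → Cops n k → Set) →
           (∀ cs → D 0 cs → Caught cs r) →
           (∀ d cs → D (suc d) cs →
              Σ[ cs′ ∈ Cops n k ] (∀ i → CopStep G (cs i) (cs′ i)) × D d cs′) →
           (∀ d cs → D (suc d) cs → ∀ r′ → G r r′ ≡ true →
              CopsWin (deleteEdge G r r′) cs r′) →
           ∀ d cs → 0 < d → D d cs →
           ∀ r′ E′ → RobberStep G r r′ E′ → CopsWin E′ cs r′

approach G r D arrive advance escape zero cs Dcs = caught (arrive cs Dcs)
approach G r D arrive advance escape (suc zero) cs Dcs =
  let (cs′ , legal , D′) = advance 0 cs Dcs in move cs′ legal (inj₁ (arrive cs′ D′))
approach G r D arrive advance escape (suc (suc d)) cs Dcs =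
  let (cs′ , legal , D′) = advance (suc d) cs Dcs in
  move cs′ legal (inj₂ (approach-reply G r D arrive advance escape (suc d) cs′ (s≤s z≤n) D′))

approach-reply G r D arrive advance escape zero cs ()
approach-reply G r D arrive advance escape (suc d) cs _ Dcs _ _ stay =
  approach G r D arrive advance escape (suc d) cs Dcs
approach-reply G r D arrive advance escape (suc d) cs _ Dcs r′ _ (go _ h) =
  escape d cs Dcs r′ h

Closed : ∀ {n} → Edges n → (Fin n → Set) → Set
Closed E S = ∀ x y → S x → E x y ≡ true → S y

stay-inside : ∀ {n k} {E : Edges n} {S : Fin n → Set} → Closed E S →
              (cs cs′ : Cops n k) → (∀ i → S (cs i)) →
              (∀ i → CopStep E (cs i) (cs′ i)) → ∀ i → S (cs′ i)
stay-inside {S = S} closed cs cs′ inside legal i with legal i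
... | inj₁ e    = subst S e (inside i)
... | inj₂ edge = closed _ _ (inside i) edge

confined-lose : ∀ {n k} (E : Edges n) (S : Fin n → Set) → Closed E S →
                (cs : Cops n k) (r : Fin n) → (∀ i → S (cs i)) → ¬ S r → ¬ CopsWin E cs r
confined-lose E S closed cs r inside outside (caught (i , e)) =
  outside (subst S e (inside i))
confined-lose E S closed cs r inside outside (move cs′ legal (inj₁ (i , e))) =
  outside (subst S e (stay-inside closed cs cs′ inside legal i))
confined-lose E S closed cs r inside outside (move cs′ legal (inj₂ next)) =
  confined-lose E S closed cs′ r (stay-inside closed cs cs′ inside legal) outside (next r E stay)

Graded : ∀ {n} → Edges n → (Fin n → ℕ) → Set
Graded E h = ∀ x y → E x y ≡ true → h y ≡ suc (h x) ⊎ h x ≡ suc (h y)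

graded-step : ∀ {n} {E : Edges n} {h} → Graded E h → ∀ {x y} → CopStep E x y → h y ≤ suc (h x)
graded-step graded (inj₁ refl) = n≤1+n _
graded-step graded (inj₂ edge) with graded _ _ edge
... | inj₁ up   = ≤-reflexive up
... | inj₂ down = ≤-trans (n≤1+n _) (≤-trans (≤-reflexive (sym down)) (n≤1+n _))

-- The robber's holding strategy in a graph graded by an injective h: while
-- every cop is at least two levels below him he waits; as soon as a cop
-- reaches the level just below, he steps up along the edge to s, burning
-- the only edge between the levels ≤ h r and the levels above.
hold-lose : ∀ {n k} (E : Edges n) (h : Fin n → ℕ) → Graded E h →
            (∀ x y → h x ≡ h y → x ≡ y) →
            ∀ r s → E r s ≡ true → h s ≡ suc (h r) →
            (cs : Cops n k) → (∀ i → 2 + h (cs i) ≤ h r) → ¬ CopsWin E cs r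
hold-lose E h graded inj r s rs up cs far (caught (i , e)) =
  <-irrefl refl (≤-trans (n≤1+n _) (subst (λ x → 2 + h x ≤ h r) e (far i)))
hold-lose E h graded inj r s rs up cs far (move cs′ legal caught′) = reply caught′
  where
  below : ∀ i → h (cs′ i) < h r
  below i = ≤-trans (s≤s (graded-step graded (legal i))) (far i)
  reply : Caught cs′ r ⊎ (∀ r′ E′ → RobberStep E r r′ E′ → CopsWin E′ cs′ r′) → ⊥
  reply (inj₁ (i , e)) = <-irrefl (cong h e) (below i)
  reply (inj₂ next) with FP.all? (λ i → 2 + h (cs′ i) ≤? h r)
  ... | yes far′ = hold-lose E h graded inj r s rs up cs′ far′ (next r E stay)
  ... | no _     = confined-lose E′ S closed cs′ s (λ i → <⇒≤ (below i))
                     (λ s≤r → <-irrefl refl (subst (_≤ h r) up s≤r)) (next s E′ (go s rs))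
    where
    E′ : Edges _
    E′ = deleteEdge E r s
    S : Fin _ → Set
    S x = h x ≤ h r
    closed : Closed E′ S
    closed x y x≤r edge with graded x y (deleteEdge-⊆ E r s edge) | h y ≤? h r
    ... | _ | yes y≤r = y≤r
    ... | inj₂ down | no y≰r = ⊥-elim (y≰r (≤-trans (n≤1+n _) (≤-trans (≤-reflexive (sym down)) x≤r)))
    ... | inj₁ y-up | no y≰r = ⊥-elim (false≢true (trans (sym (deleteEdge-removes E r s)) edge′))
      where
      x≡r : x ≡ r
      x≡r = inj x r (≤-antisym x≤r (≤-pred (subst (h r <_) y-up (≰⇒> y≰r))))
      y≡s : y ≡ s
      y≡s = inj y s (trans y-up (trans (cong (λ z → suc (h z)) x≡r) (sym up)))
      edge′ : E′ r s ≡ true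
      edge′ = subst₂ (λ a b → E′ a b ≡ true) x≡r y≡s edge

-- Rotating Fin (suc n) one step forward and backward: the successor and
-- predecessor of a vertex on the cycle 0 - 1 - … - n - 0.
csucc : ∀ {n} → Fin (suc n) → Fin (suc n)
csucc {n} x with n ℕ.≟ toℕ x
... | yes _   = F.zero
... | no n≢x  = F.suc (F.lower₁ x n≢x)

cpred : ∀ {n} → Fin (suc n) → Fin (suc n)
cpred F.zero    = F.fromℕ _
cpred (F.suc x) = F.inject₁ x

csucc-last : ∀ {n} (x : Fin (suc n)) → toℕ x ≡ n → csucc x ≡ F.zero
csucc-last {n} x x≡n with n ℕ.≟ toℕ x
... | yes _   = refl
... | no n≢x  = ⊥-elim (n≢x (sym x≡n))

toℕ-csucc : ∀ {n} (x : Fin (suc n)) → toℕ x ≢ n → toℕ (csucc x) ≡ suc (toℕ x)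
toℕ-csucc {n} x x≢n with n ℕ.≟ toℕ x
... | yes n≡x = ⊥-elim (x≢n (sym n≡x))
... | no n≢x  = cong suc (FP.toℕ-lower₁ x n≢x)

toℕ-cpred : ∀ {n} (x : Fin (suc n)) → toℕ x ≢ 0 → suc (toℕ (cpred x)) ≡ toℕ x
toℕ-cpred F.zero    x≢0 = ⊥-elim (x≢0 refl)
toℕ-cpred (F.suc x) _   = cong suc (FP.toℕ-inject₁ x)

cpred-csucc : ∀ {n} (x : Fin (suc n)) → cpred (csucc x) ≡ x
cpred-csucc {n} x with n ℕ.≟ toℕ x
... | yes n≡x = FP.toℕ-injective (trans (FP.toℕ-fromℕ n) n≡x)
... | no n≢x  = FP.inject₁-lower₁ x n≢x

csucc-cpred : ∀ {n} (x : Fin (suc n)) → csucc (cpred x) ≡ x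
csucc-cpred {n} F.zero    = csucc-last (F.fromℕ n) (FP.toℕ-fromℕ n)
csucc-cpred {n} (F.suc x) with n ℕ.≟ toℕ (F.inject₁ x)
... | yes n≡x = ⊥-elim (FP.toℕ-inject₁-≢ x n≡x)
... | no n≢x  = cong F.suc (FP.lower₁-inject₁′ x n≢x)

path-levels : ∀ {n} (x y : Fin n) → path n x y ≡ true →
              toℕ y ≡ suc (toℕ x) ⊎ toℕ x ≡ suc (toℕ y)
path-levels x y h with ∨-true ⌊ suc (toℕ x) ℕ.≟ toℕ y ⌋ h
... | inj₁ up   = inj₁ (sym (≟-sound up))
... | inj₂ down = inj₂ (sym (≟-sound down))

path-edge : ∀ {n} (x y : Fin n) → toℕ y ≡ suc (toℕ x) ⊎ toℕ x ≡ suc (toℕ y) →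
            path n x y ≡ true
path-edge x y (inj₁ up)   = ∨-trueˡ _ (≟-complete (sym up))
path-edge x y (inj₂ down) = ∨-trueʳ _ (≟-complete (sym down))

path⊆cycle : ∀ {n} (x y : Fin n) → path n x y ≡ true → cycle n x y ≡ true
path⊆cycle x y = ∨-trueˡ _

cycle-neighbours : ∀ {n} (x y : Fin (suc n)) → cycle (suc n) x y ≡ true →
                   y ≡ csucc x ⊎ y ≡ cpred x
cycle-neighbours {n} x y h with ∨-true (path _ x y) h
... | inj₁ p with path-levels x y p
...   | inj₁ up   = inj₁ (FP.toℕ-injective (trans up (sym (toℕ-csucc x x≢n))))
  where
  x≢n : toℕ x ≢ n
  x≢n x≡n = <-irrefl refl (subst (_≤ n) (trans up (cong suc x≡n)) (FP.toℕ≤pred[n] y))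
...   | inj₂ down = inj₂ (FP.toℕ-injective (suc-injective
                      (trans (sym down) (sym (toℕ-cpred x (λ x≡0 → 0≢1+n (trans (sym x≡0) down)))))))
cycle-neighbours {n} x y h | inj₂ wrap with ∨-true _ wrap
... | inj₁ first with ∧-true _ first
...   | x≡0 , y≡n = inj₂ (FP.toℕ-injective (trans (suc-injective (≟-sound y≡n))
                      (sym (trans (cong (λ z → toℕ (cpred z)) x≡zero) (FP.toℕ-fromℕ n)))))
  where
  x≡zero : x ≡ F.zero
  x≡zero = FP.toℕ-injective (≟-sound x≡0)
cycle-neighbours {n} x y h | inj₂ wrap | inj₂ second with ∧-true _ second
...   | y≡0 , x≡n = inj₁ (trans (FP.toℕ-injective (≟-sound y≡0))
                      (sym (csucc-last x (suc-injective (≟-sound x≡n)))))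

path-csucc : ∀ {n} (x : Fin (suc n)) → toℕ x ≢ n → path (suc n) x (csucc x) ≡ true
path-csucc x x≢n = path-edge x (csucc x) (inj₁ (toℕ-csucc x x≢n))

path-cpred : ∀ {n} (x : Fin (suc n)) → toℕ x ≢ 0 → path (suc n) x (cpred x) ≡ true
path-cpred x x≢0 = path-edge x (cpred x) (inj₂ (sym (toℕ-cpred x x≢0)))

cycle-csucc : ∀ {n} (x : Fin (suc n)) → cycle (suc n) x (csucc x) ≡ true
cycle-csucc {n} x with toℕ x ℕ.≟ n
... | no x≢n  = path⊆cycle x (csucc x) (path-csucc x x≢n)
... | yes x≡n =
  ∨-trueʳ (path (suc n) x (csucc x))
    (∨-trueʳ (⌊ toℕ x ℕ.≟ 0 ⌋ ∧ ⌊ suc (toℕ (csucc x)) ℕ.≟ suc n ⌋)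
      (∧-intro (≟-complete (cong toℕ (csucc-last x x≡n))) (≟-complete (cong suc x≡n))))

cycle-cpred : ∀ {n} (x : Fin (suc n)) → cycle (suc n) x (cpred x) ≡ true
cycle-cpred {n} F.zero = ∨-trueʳ (path (suc n) F.zero (F.fromℕ n)) (∨-trueˡ _
                           (∧-intro refl (≟-complete (cong suc (FP.toℕ-fromℕ n)))))
cycle-cpred (F.suc x) = path⊆cycle (F.suc x) (F.inject₁ x) (path-cpred (F.suc x) λ ())

iterate : ∀ {A : Set} → (A → A) → ℕ → A → A
iterate f zero    x = x
iterate f (suc i) x = f (iterate f i x)

iterate-+ : ∀ {A : Set} (f : A → A) i j x → iterate f (i + j) x ≡ iterate f i (iterate f j x)
iterate-+ f zero    j x = refl
iterate-+ f (suc i) j x = cong f (iterate-+ f i j x)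

toℕ-forward : ∀ {n} (c : Fin (suc n)) i → toℕ c + i ≤ n →
              toℕ (iterate csucc i c) ≡ toℕ c + i
toℕ-forward c zero _ = sym (+-identityʳ _)
toℕ-forward {n} c (suc i) c+i<n =
  begin
    toℕ (csucc (iterate csucc i c)) ≡⟨ toℕ-csucc _ (λ e → <-irrefl (trans (sym ih) e) c+i<n′) ⟩
    suc (toℕ (iterate csucc i c))   ≡⟨ cong suc ih ⟩
    suc (toℕ c + i)                 ≡⟨ +-suc (toℕ c) i ⟨
    toℕ c + suc i                   ∎
  where
  open ≡-Reasoning
  c+i<n′ : toℕ c + i < n
  c+i<n′ = subst (_≤ n) (+-suc (toℕ c) i) c+i<n
  ih : toℕ (iterate csucc i c) ≡ toℕ c + i
  ih = toℕ-forward c i (<⇒≤ c+i<n′)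

toℕ-backward : ∀ {n} (c : Fin (suc n)) i → i ≤ toℕ c →
               toℕ (iterate cpred i c) ≡ toℕ c ∸ i
toℕ-backward c zero _ = refl
toℕ-backward c (suc i) i<c =
  begin
    toℕ (cpred (iterate cpred i c))       ≡⟨ cong ℕ.pred (toℕ-cpred (iterate cpred i c) x≢0) ⟩
    ℕ.pred (toℕ (iterate cpred i c))      ≡⟨ cong ℕ.pred ih ⟩
    ℕ.pred (toℕ c ∸ i)                    ≡⟨ pred[m∸n]≡m∸[1+n] (toℕ c) i ⟩
    toℕ c ∸ suc i                         ∎
  where
  open ≡-Reasoning
  ih : toℕ (iterate cpred i c) ≡ toℕ c ∸ i
  ih = toℕ-backward c i (<⇒≤ i<c)
  x≢0 : toℕ (iterate cpred i c) ≢ 0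
  x≢0 e = m>n⇒m∸n≢0 i<c (trans (sym ih) e)

toℕ-backward-lap : ∀ {n} (c : Fin (suc n)) j → j ≤ n →
                   toℕ (iterate cpred (j + suc (toℕ c)) c) ≡ n ∸ j
toℕ-backward-lap {n} c j j≤n =
  begin
    toℕ (iterate cpred (j + suc (toℕ c)) c)  ≡⟨ cong toℕ (iterate-+ cpred j (suc (toℕ c)) c) ⟩
    toℕ (iterate cpred j (cpred z))          ≡⟨ cong (λ x → toℕ (iterate cpred j (cpred x))) z≡0 ⟩
    toℕ (iterate cpred j (F.fromℕ n))        ≡⟨ toℕ-backward (F.fromℕ n) j
                                                  (subst (j ≤_) (sym (FP.toℕ-fromℕ n)) j≤n) ⟩
    toℕ (F.fromℕ n) ∸ j                      ≡⟨ cong (_∸ j) (FP.toℕ-fromℕ n) ⟩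
    n ∸ j                                    ∎
  where
  open ≡-Reasoning
  z : Fin (suc n)
  z = iterate cpred (toℕ c) c
  z≡0 : z ≡ F.zero
  z≡0 = FP.toℕ-injective (trans (toℕ-backward c (toℕ c) ≤-refl) (n∸n≡0 (toℕ c)))

-- Number of forward steps from c to y (for toℕ c ≤ toℕ y).
forwardSteps : ∀ {n} → Fin (suc n) → Fin (suc n) → ℕ
forwardSteps c y = toℕ y ∸ toℕ c

forwardSteps-iterate : ∀ {n} (c : Fin (suc n)) i → toℕ c + i ≤ n →
                       forwardSteps c (iterate csucc i c) ≡ i
forwardSteps-iterate c i c+i≤n =
  trans (cong (_∸ toℕ c) (toℕ-forward c i c+i≤n)) (m+n∸m≡n (toℕ c) i)

iterate-forwardSteps : ∀ {n} (c y : Fin (suc n)) → toℕ c ≤ toℕ y →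
                       iterate csucc (forwardSteps c y) c ≡ y
iterate-forwardSteps c y c≤y = FP.toℕ-injective
  (trans (toℕ-forward c _ (subst (_≤ _) (sym (m+[n∸m]≡n c≤y)) (FP.toℕ≤pred[n] y)))
         (m+[n∸m]≡n c≤y))

-- Number of backward steps from c to y, possibly wrapping past vertex 0.
backwardSteps : ∀ {n} → Fin (suc n) → Fin (suc n) → ℕ
backwardSteps {n} c y with toℕ y ≤? toℕ c
... | yes _ = toℕ c ∸ toℕ y
... | no _  = (n ∸ toℕ y) + suc (toℕ c)

backwardSteps-below : ∀ {n} (c y : Fin (suc n)) → toℕ y ≤ toℕ c →
                      backwardSteps c y ≡ toℕ c ∸ toℕ y
backwardSteps-below c y y≤c with toℕ y ≤? toℕ c
... | yes _   = refl
... | no y≰c  = ⊥-elim (y≰c y≤c)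

backwardSteps-above : ∀ {n} (c y : Fin (suc n)) → toℕ c < toℕ y →
                      backwardSteps {n} c y ≡ (n ∸ toℕ y) + suc (toℕ c)
backwardSteps-above c y c<y with toℕ y ≤? toℕ c
... | yes y≤c = ⊥-elim (<⇒≱ c<y y≤c)
... | no _    = refl

iterate-backwardSteps : ∀ {n} (c y : Fin (suc n)) → iterate cpred (backwardSteps c y) c ≡ y
iterate-backwardSteps {n} c y with toℕ y ≤? toℕ c
... | yes y≤c = FP.toℕ-injective
                  (trans (toℕ-backward c _ (m∸n≤m (toℕ c) (toℕ y))) (m∸[m∸n]≡n y≤c))
... | no _    = FP.toℕ-injective
                  (trans (toℕ-backward-lap c _ (m∸n≤m n (toℕ y))) (m∸[m∸n]≡n (FP.toℕ≤pred[n] y)))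

-- Within one lap the backward walk visits distinct vertices.
backwardSteps-iterate : ∀ {n} (c : Fin (suc n)) i → i ≤ n →
                        backwardSteps c (iterate cpred i c) ≡ i
backwardSteps-iterate {n} c i i≤n with i ≤? toℕ c
... | yes i≤c = trans (backwardSteps-below c _ (subst (_≤ toℕ c) (sym x≡) (m∸n≤m (toℕ c) i)))
                      (trans (cong (toℕ c ∸_) x≡) (m∸[m∸n]≡n i≤c))
  where
  x≡ : toℕ (iterate cpred i c) ≡ toℕ c ∸ i
  x≡ = toℕ-backward c i i≤c
... | no i≰c = subst (λ k → backwardSteps c (iterate cpred k c) ≡ k) i≡ lapped
  where
  j : ℕ
  j = i ∸ suc (toℕ c)
  i≡ : j + suc (toℕ c) ≡ i
  i≡ = m∸n+n≡m (≰⇒> i≰c)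
  j≤n : j ≤ n
  j≤n = ≤-trans (m∸n≤m i (suc (toℕ c))) i≤n
  x≡ : toℕ (iterate cpred (j + suc (toℕ c)) c) ≡ n ∸ j
  x≡ = toℕ-backward-lap c j j≤n
  c<x : toℕ c < n ∸ j
  c<x = m+n≤o⇒m≤o∸n (suc (toℕ c)) (subst (_≤ n) (trans (sym i≡) (+-comm j _)) i≤n)
  lapped : backwardSteps c (iterate cpred (j + suc (toℕ c)) c) ≡ j + suc (toℕ c)
  lapped = trans (backwardSteps-above c _ (subst (toℕ c <_) (sym x≡) c<x))
                 (trans (cong (λ x → (n ∸ x) + suc (toℕ c)) x≡)
                        (cong (_+ suc (toℕ c)) (m∸[m∸n]≡n j≤n)))

-- If ψ counts steps along the orbit (so its first m + 2 points are
-- distinct) and the robber has just arrived at its m-th point from the next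
-- one, burning that edge, then the orbit up to the robber is a corridor.
orbitCorridor : ∀ {n} (G : Edges n) (f g : Fin n → Fin n) (ψ : Fin n → ℕ) (c : Fin n) m →
  (∀ x → g (f x) ≡ x) →
  (∀ x y → G x y ≡ true → y ≡ f x ⊎ y ≡ g x) →
  (∀ i → i < m → G (iterate f i c) (iterate f (suc i) c) ≡ true) →
  (∀ i → i ≤ suc m → ψ (iterate f i c) ≡ i) →
  Corridor (deleteEdge G (f (iterate f m c)) (iterate f m c)) (λ i → iterate f i c) m
orbitCorridor G f g ψ c m undo neighbours steps counts = record
  { linked   = linked
  ; distinct = λ i j i≤m j≤m → distinct′ i j (m≤n⇒m≤1+n i≤m) (m≤n⇒m≤1+n j≤m)
  ; confined = confined
  }
  where
  ℓ : ℕ → _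
  ℓ i = iterate f i c
  E : Edges _
  E = deleteEdge G (f (ℓ m)) (ℓ m)
  distinct′ : ∀ i j → i ≤ suc m → j ≤ suc m → ℓ i ≡ ℓ j → i ≡ j
  distinct′ i j i≤ j≤ e = trans (sym (counts i i≤)) (trans (cong ψ e) (counts j j≤))
  linked : ∀ i → i < m → E (ℓ i) (ℓ (suc i)) ≡ true
  linked i i<m = trans
    (deleteEdge-keeps G (f (ℓ m)) (ℓ m)
       (λ e → <-irrefl (distinct′ i (suc m) (≤-trans (<⇒≤ i<m) (n≤1+n m)) ≤-refl e) (m≤n⇒m≤1+n i<m))
       (λ e → <-irrefl (distinct′ i m (≤-trans (<⇒≤ i<m) (n≤1+n m)) (n≤1+n m) e) i<m))
    (steps i i<m)
  confined : ∀ i y → i < m → E (ℓ (suc i)) y ≡ true → y ≡ ℓ i ⊎ (suc i < m × y ≡ ℓ (suc (suc i)))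
  confined i y i<m h with neighbours (ℓ (suc i)) y (deleteEdge-⊆ G _ _ h)
  ... | inj₂ back = inj₁ (trans back (undo (ℓ i)))
  ... | inj₁ fwd with suc i <? m
  ...   | yes si<m = inj₂ (si<m , fwd)
  ...   | no si≮m with ≤-antisym i<m (≮⇒≥ si≮m)
  ...     | refl = ⊥-elim (false≢true (trans (sym (deleteEdge-removes′ G (f (ℓ m)) (ℓ m)))
                                                (subst (λ z → E (ℓ m) z ≡ true) fwd h)))

_⊆cycle : ∀ {n} → Edges (suc n) → Set
G ⊆cycle = ∀ x y → G x y ≡ true → cycle _ x y ≡ true

-- A robber who has just stepped back from csucc y to y, with a cop at c
-- no further than y and the forward walk from c to y made of edges of G,
-- is caught: he is at the dead end of the forward corridor from c.
chaseForward : ∀ {n k} (G : Edges (suc n)) → G ⊆cycle →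
  (∀ x → toℕ x < n → G x (csucc x) ≡ true) →
  (cs : Cops (suc n) k) (p : Fin k) (y : Fin (suc n)) → toℕ (cs p) ≤ toℕ y → toℕ y < n →
  CopsWin (deleteEdge G (csucc y) y) cs y
chaseForward {n} G sub step cs p y c≤y y<n =
  subst (λ z → CopsWin (deleteEdge G (csucc z) z) cs z) (iterate-forwardSteps c y c≤y)
    (chase m cs p refl
       (orbitCorridor G csucc cpred (forwardSteps c) c m cpred-csucc
          (λ x z e → cycle-neighbours x z (sub x z e)) steps counts))
  where
  c : Fin (suc n)
  c = cs p
  m : ℕ
  m = forwardSteps c y
  c+m≡y : toℕ c + m ≡ toℕ y
  c+m≡y = m+[n∸m]≡n c≤y
  steps : ∀ i → i < m → G (iterate csucc i c) (iterate csucc (suc i) c) ≡ true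
  steps i i<m = step _ (subst (_< n) (sym (toℕ-forward c i c+i≤n))
                          (<-≤-trans (+-monoʳ-< (toℕ c) i<m) (≤-trans (≤-reflexive c+m≡y) (<⇒≤ y<n))))
    where c+i≤n = ≤-trans (+-monoʳ-≤ (toℕ c) (<⇒≤ i<m)) (≤-trans (≤-reflexive c+m≡y) (<⇒≤ y<n))
  counts : ∀ i → i ≤ suc m → forwardSteps c (iterate csucc i c) ≡ i
  counts i i≤ = forwardSteps-iterate c i
    (≤-trans (+-monoʳ-≤ (toℕ c) i≤) (subst (_≤ n) (sym (trans (+-suc (toℕ c) m) (cong suc c+m≡y))) y<n))

chaseBackward : ∀ {n k} (G : Edges (suc n)) → G ⊆cycle →
  (cs : Cops (suc n) k) (p : Fin k) (y : Fin (suc n)) → backwardSteps (cs p) y < n →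
  (∀ i → i < backwardSteps (cs p) y →
     G (iterate cpred i (cs p)) (cpred (iterate cpred i (cs p))) ≡ true) →
  CopsWin (deleteEdge G (cpred y) y) cs y
chaseBackward {n} G sub cs p y m<n steps =
  subst (λ z → CopsWin (deleteEdge G (cpred z) z) cs z) (iterate-backwardSteps (cs p) y)
    (chase m cs p refl
       (orbitCorridor G cpred csucc (backwardSteps (cs p)) (cs p) m csucc-cpred
          (λ x z e → Sum.swap (cycle-neighbours x z (sub x z e))) steps
          (λ i i≤ → backwardSteps-iterate (cs p) i (≤-trans i≤ m<n))))
  where
  m : ℕ
  m = backwardSteps (cs p) y

Behind : ∀ {n k} → Cops n k → Fin k → Fin n → ℕ → Set
Behind cs p r d = toℕ (cs p) + d ≡ toℕ r

pursuer-arrives : ∀ {n k} (cs : Cops (suc n) k) p r → Behind cs p r 0 → Caught cs r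
pursuer-arrives cs p r behind = p , FP.toℕ-injective (trans (sym (+-identityʳ _)) behind)

pursuer-advance : ∀ {n k} (G : Edges (suc n)) → (∀ x → toℕ x < n → G x (csucc x) ≡ true) →
  (cs : Cops (suc n) k) (p : Fin k) (r : Fin (suc n)) (d : ℕ) → Behind cs p r (suc d) →
  let cs′ = moveCop cs p (csucc (cs p)) in
  (∀ i → CopStep G (cs i) (cs′ i)) × Behind cs′ p r d
pursuer-advance {n} G step cs p r d behind =
  moveCop-legal G cs p _ (step (cs p) c<n) ,
  (begin
     toℕ (moveCop cs p (csucc (cs p)) p) + d ≡⟨ cong (λ x → toℕ x + d) (moveCop-moved cs p _) ⟩
     toℕ (csucc (cs p)) + d                  ≡⟨ cong (_+ d) (toℕ-csucc (cs p) (<⇒≢ c<n)) ⟩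
     suc (toℕ (cs p)) + d                    ≡⟨ +-suc (toℕ (cs p)) d ⟨
     toℕ (cs p) + suc d                      ≡⟨ behind ⟩
     toℕ r                                   ∎)
  where
  open ≡-Reasoning
  c<n : toℕ (cs p) < n
  c<n = <-≤-trans (subst (toℕ (cs p) <_) behind (m<m+n (toℕ (cs p)) (s≤s z≤n))) (FP.toℕ≤pred[n] r)

-- A robber stepping back towards the pursuer ends at the dead end of the
-- forward corridor starting at the pursuer.
back-towards-pursuer : ∀ {n k} (G : Edges (suc n)) → G ⊆cycle →
  (∀ x → toℕ x < n → G x (csucc x) ≡ true) →
  (cs : Cops (suc n) k) (p : Fin k) (r : Fin (suc n)) (d : ℕ) → Behind cs p r (suc d) →
  ∀ r′ → r′ ≡ cpred r → CopsWin (deleteEdge G r r′) cs r′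
back-towards-pursuer G sub step cs p r d behind r′ refl =
  subst (λ z → CopsWin (deleteEdge G z (cpred r)) cs (cpred r)) (csucc-cpred r)
    (chaseForward G sub step cs p (cpred r) c≤r′ r′<n)
  where
  r≢0 : toℕ r ≢ 0
  r≢0 e = 0≢1+n (trans (sym e) (trans (sym behind) (+-suc (toℕ (cs p)) d)))
  r′+1≡r : suc (toℕ (cpred r)) ≡ toℕ r
  r′+1≡r = toℕ-cpred r r≢0
  c≤r′ : toℕ (cs p) ≤ toℕ (cpred r)
  c≤r′ = subst (toℕ (cs p) ≤_)
           (sym (suc-injective (trans r′+1≡r (trans (sym behind) (+-suc (toℕ (cs p)) d)))))
           (m≤m+n (toℕ (cs p)) d)
  r′<n = <-≤-trans (≤-reflexive r′+1≡r) (FP.toℕ≤pred[n] r)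

-- When the robber at r runs forward, the backward walk from a cop at c < r
-- to his new position stays within one lap, avoiding the burnt edge.
backwardSteps-past : ∀ {n} (c r : Fin (suc n)) → toℕ c < toℕ r → backwardSteps c (csucc r) < n
backwardSteps-past {n} c r c<r with toℕ r ℕ.≟ n
... | yes r≡n rewrite csucc-last r r≡n | backwardSteps-below c F.zero z≤n =
  subst (toℕ c <_) r≡n c<r
... | no r≢n rewrite backwardSteps-above c (csucc r) (subst (toℕ c <_) (sym (toℕ-csucc r r≢n)) (m≤n⇒m≤1+n c<r))
                   | toℕ-csucc r r≢n =
  begin-strict
    (n ∸ suc (toℕ r)) + suc (toℕ c) <⟨ +-monoʳ-< (n ∸ suc (toℕ r)) (s≤s c<r) ⟩
    (n ∸ suc (toℕ r)) + suc (toℕ r) ≡⟨ m∸n+n≡m (≤∧≢⇒< (FP.toℕ≤pred[n] r) r≢n) ⟩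
    n                               ∎
  where open ≤-Reasoning

-- (b) One cop wins on a cycle: starting at 0 he walks forward towards the
-- robber; a robber running forward or backward burns the edge behind him
-- and ends at the dead end of a backward or forward corridor.
cycle-oneCop : ∀ n → KCopsWin (cycle (suc n)) 1
cycle-oneCop n = (λ _ → F.zero) , λ r →
  approach (cycle (suc n)) r (λ d cs → Behind cs F.zero r d)
    (λ cs → pursuer-arrives cs F.zero r)
    (λ d cs behind → _ , pursuer-advance (cycle (suc n)) (λ x _ → cycle-csucc x) cs F.zero r d behind)
    (escape r) (toℕ r) (λ _ → F.zero) refl
  where
  escape : ∀ r d (cs : Cops (suc n) 1) → Behind cs F.zero r (suc d) →
           ∀ r′ → cycle (suc n) r r′ ≡ true → CopsWin (deleteEdge (cycle (suc n)) r r′) cs r′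
  escape r d cs behind r′ edge with cycle-neighbours r r′ edge
  ... | inj₂ backward = back-towards-pursuer (cycle (suc n)) (λ _ _ e → e) (λ x _ → cycle-csucc x)
                          cs F.zero r d behind r′ backward
  ... | inj₁ refl =
    subst (λ z → CopsWin (deleteEdge (cycle (suc n)) z (csucc r)) cs (csucc r)) (cpred-csucc r)
      (chaseBackward (cycle (suc n)) (λ _ _ e → e) cs F.zero (csucc r)
         (backwardSteps-past (cs F.zero) r c<r) (λ i _ → cycle-cpred (iterate cpred i (cs F.zero))))
    where
    c<r : toℕ (cs F.zero) < toℕ r
    c<r = subst (toℕ (cs F.zero) <_) behind (m<m+n _ (s≤s z≤n))

-- Two cops win on every path: one guards the last vertex n while the other
-- walks forward from 0.  A robber stepping back meets the walking cop's
-- forward corridor; a robber stepping forward is at the dead end of the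
-- guard's backward corridor, which never wraps past 0.
guard-catches : ∀ {n k} (cs : Cops (suc n) k) (p : Fin k) → cs p ≡ F.fromℕ n →
  ∀ r → toℕ r < n → CopsWin (deleteEdge (path (suc n)) r (csucc r)) cs (csucc r)
guard-catches {n} cs p guard r r<n =
  subst (λ z → CopsWin (deleteEdge (path (suc n)) z (csucc r)) cs (csucc r)) (cpred-csucc r)
    (chaseBackward (path (suc n)) path⊆cycle cs p (csucc r)
       (subst (_< n) (sym m≡) (∸-monoʳ-< (s≤s z≤n) r<n))
       (λ i i<m → path-cpred _ (walk≢0 i (subst (i <_) m≡ i<m))))
  where
  r′≡ : toℕ (csucc r) ≡ suc (toℕ r)
  r′≡ = toℕ-csucc r (<⇒≢ r<n)
  top≡n : toℕ (cs p) ≡ n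
  top≡n = trans (cong toℕ guard) (FP.toℕ-fromℕ n)
  m≡ : backwardSteps (cs p) (csucc r) ≡ n ∸ suc (toℕ r)
  m≡ = trans (backwardSteps-below (cs p) (csucc r) (subst₂ _≤_ (sym r′≡) (sym top≡n) r<n))
             (cong₂ _∸_ top≡n r′≡)
  walk≢0 : ∀ i → i < n ∸ suc (toℕ r) → toℕ (iterate cpred i (cs p)) ≢ 0
  walk≢0 i i<m e = m>n⇒m∸n≢0 i<n (trans (sym (cong (_∸ i) top≡n)) (trans (sym walk) e))
    where
    i<n : i < n
    i<n = <-≤-trans i<m (m∸n≤m n (suc (toℕ r)))
    walk : toℕ (iterate cpred i (cs p)) ≡ toℕ (cs p) ∸ i
    walk = toℕ-backward (cs p) i (subst (i ≤_) (sym top≡n) (<⇒≤ i<n))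

path-twoCops : ∀ n → KCopsWin (path (suc n)) 2
path-twoCops n = cops , win
  where
  cops : Cops (suc n) 2
  cops F.zero    = F.zero
  cops (F.suc _) = F.fromℕ n
  forward : ∀ x → toℕ x < n → path (suc n) x (csucc x) ≡ true
  forward x x<n = path-csucc x (<⇒≢ x<n)
  win : ∀ r → CopsWin (path (suc n)) cops r
  win r with toℕ r ℕ.≟ n
  ... | yes r≡n = caught (F.suc F.zero , FP.toℕ-injective (trans (FP.toℕ-fromℕ n) (sym r≡n)))
  ... | no r≢n  = approach (path (suc n)) r D
                    (λ cs (_ , behind) → pursuer-arrives cs F.zero r behind)
                    advance escape (toℕ r) cops (refl , refl)
    where
    D : ℕ → Cops (suc n) 2 → Set
    D d cs = cs (F.suc F.zero) ≡ F.fromℕ n × Behind cs F.zero r d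
    advance : ∀ d cs → D (suc d) cs →
              Σ[ cs′ ∈ Cops (suc n) 2 ] (∀ i → CopStep (path (suc n)) (cs i) (cs′ i)) × D d cs′
    advance d cs (guard , behind) =
      let (legal , behind′) = pursuer-advance (path (suc n)) forward cs F.zero r d behind
      in _ , legal , guard , behind′
    escape : ∀ d cs → D (suc d) cs → ∀ r′ → path (suc n) r r′ ≡ true →
             CopsWin (deleteEdge (path (suc n)) r r′) cs r′
    escape d cs (guard , behind) r′ edge with cycle-neighbours r r′ (path⊆cycle r r′ edge)
    ... | inj₁ refl     = guard-catches cs (F.suc F.zero) guard r (≤∧≢⇒< (FP.toℕ≤pred[n] r) r≢n)
    ... | inj₂ backward = back-towards-pursuer (path (suc n)) path⊆cycle forward cs F.zero r d behind r′ backward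

-- (c, small paths) One cop wins on a path with at most five vertices by
-- starting in the middle: the robber is adjacent to the cop or sits at an
-- end of the path two steps away.
path-oneCop-small : ∀ n → n ≤ 4 → KCopsWin (path (suc n)) 1
path-oneCop-small 0 _ = (λ _ → F.zero) , λ { F.zero → caught (F.zero , refl) }
path-oneCop-small 1 _ = (λ _ → F.zero) , λ
  { F.zero           → caught (F.zero , refl)
  ; (F.suc F.zero)   → capture-adjacent _ _ F.zero _ refl
  }
path-oneCop-small 2 _ = (λ _ → # 1) , λ
  { F.zero                   → capture-adjacent _ _ F.zero _ refl
  ; (F.suc F.zero)           → caught (F.zero , refl)
  ; (F.suc (F.suc F.zero))   → capture-adjacent _ _ F.zero _ refl
  }
path-oneCop-small 3 _ = (λ _ → # 1) , λ
  { F.zero                         → capture-adjacent _ _ F.zero _ refl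
  ; (F.suc F.zero)                 → caught (F.zero , refl)
  ; (F.suc (F.suc F.zero))         → capture-adjacent _ _ F.zero _ refl
  ; (F.suc (F.suc (F.suc F.zero))) → capture-leaf _ _ F.zero _ (# 2) refl refl λ
      { F.zero () ; (F.suc F.zero) () ; (F.suc (F.suc F.zero)) _ → refl
      ; (F.suc (F.suc (F.suc F.zero))) () }
  }
path-oneCop-small 4 _ = (λ _ → # 2) , λ
  { F.zero                                 → capture-leaf _ _ F.zero _ (# 1) refl refl λ
      { F.zero () ; (F.suc F.zero) _ → refl ; (F.suc (F.suc F.zero)) ()
      ; (F.suc (F.suc (F.suc F.zero))) () ; (F.suc (F.suc (F.suc (F.suc F.zero)))) () }
  ; (F.suc F.zero)                         → capture-adjacent _ _ F.zero _ refl
  ; (F.suc (F.suc F.zero))                 → caught (F.zero , refl)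
  ; (F.suc (F.suc (F.suc F.zero)))         → capture-adjacent _ _ F.zero _ refl
  ; (F.suc (F.suc (F.suc (F.suc F.zero)))) → capture-leaf _ _ F.zero _ (# 3) refl refl λ
      { F.zero () ; (F.suc F.zero) () ; (F.suc (F.suc F.zero)) ()
      ; (F.suc (F.suc (F.suc F.zero))) _ → refl ; (F.suc (F.suc (F.suc (F.suc F.zero)))) () }
  }
path-oneCop-small (suc (suc (suc (suc (suc n))))) (s≤s (s≤s (s≤s (s≤s ()))))

-- The robber's winning position against one cop in a graded graph: if σ
-- climbs one level along an edge below level t and the cop is at least
-- three levels below t, the robber waits two levels above the cop, with
-- the next level up still available to escape to.
climb-lose : ∀ {n} (E : Edges n) (h : Fin n → ℕ) → Graded E h → (∀ x y → h x ≡ h y → x ≡ y) →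
  (σ : Fin n → Fin n) (t : ℕ) → (∀ x → h x < t → E x (σ x) ≡ true × h (σ x) ≡ suc (h x)) →
  (cs : Cops n 1) → h (cs F.zero) + 3 ≤ t → ¬ CopsWin E cs (σ (σ (cs F.zero)))
climb-lose E h graded inj σ t climb cs room =
  hold-lose E h graded inj r s (Product.proj₁ (climb r r<t)) (Product.proj₂ (climb r r<t)) cs
    λ { F.zero → ≤-reflexive (sym r-level) }
  where
  c r s : Fin _
  c = cs F.zero
  r = σ (σ c)
  s = σ r
  room′ : 3 + h c ≤ t
  room′ = subst (_≤ t) (+-comm (h c) 3) room
  σc-level : h (σ c) ≡ suc (h c)
  σc-level = Product.proj₂ (climb c (≤-trans (s≤s (m≤n+m (h c) 2)) room′))
  r-level : h r ≡ 2 + h c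
  r-level = trans (Product.proj₂ (climb (σ c) σc<t)) (cong suc σc-level)
    where
    σc<t : h (σ c) < t
    σc<t = subst (_< t) (sym σc-level) (≤-trans (s≤s (s≤s (m≤n+m (h c) 1))) room′)
  r<t : h r < t
  r<t = subst (_< t) (sym r-level) room′

reflect-step : ∀ {n a b} → suc a ≡ b → b ≤ n → n ∸ a ≡ suc (n ∸ b)
reflect-step {n} {a} refl b≤n = +-∸-assoc 1 {n} {suc a} b≤n

path-reflected-graded : ∀ n → Graded (path (suc n)) (λ x → n ∸ toℕ x)
path-reflected-graded n x y edge with path-levels x y edge
... | inj₁ up   = inj₂ (reflect-step (sym up) (FP.toℕ≤pred[n] y))
... | inj₂ down = inj₁ (reflect-step (sym down) (FP.toℕ≤pred[n] x))

-- (c, long paths) One cop loses on a path with at least six vertices: on one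
-- side of the cop there are at least three further vertices, and the
-- robber plays 'climb-lose' on that side.
path-oneCop-loses : ∀ n → 5 ≤ n → ¬ KCopsWin (path (suc n)) 1
path-oneCop-loses n 5≤n (cs , win) with toℕ (cs F.zero) + 3 ≤? n
... | yes room = climb-lose (path (suc n)) toℕ path-levels (λ _ _ → FP.toℕ-injective) csucc n
                   (λ x x<n → path-csucc x (<⇒≢ x<n) , toℕ-csucc x (<⇒≢ x<n)) cs room (win _)
... | no no-room = climb-lose (path (suc n)) (λ x → n ∸ toℕ x) (path-reflected-graded n)
                     (λ x y e → FP.toℕ-injective (∸-cancelˡ-≡ (FP.toℕ≤pred[n] x) (FP.toℕ≤pred[n] y) e))
                     cpred n descend cs room′ (win _)
  where
  c : ℕ
  c = toℕ (cs F.zero)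
  descend : ∀ x → n ∸ toℕ x < n →
            path (suc n) x (cpred x) ≡ true × n ∸ toℕ (cpred x) ≡ suc (n ∸ toℕ x)
  descend x top<n = path-cpred x x≢0 , reflect-step (toℕ-cpred x x≢0) (FP.toℕ≤pred[n] x)
    where
    x≢0 : toℕ x ≢ 0
    x≢0 x≡0 = <-irrefl (cong (n ∸_) x≡0) top<n
  3≤c : 3 ≤ c
  3≤c = +-cancelʳ-≤ 2 3 c (≤-trans 5≤n (≤-pred (subst (n <_) (+-suc c 2) (≰⇒> no-room))))
  room′ : (n ∸ c) + 3 ≤ n
  room′ = ≤-trans (+-monoʳ-≤ (n ∸ c) 3≤c) (≤-reflexive (m∸n+n≡m (FP.toℕ≤pred[n] (cs F.zero))))

complete-edge : ∀ {n} (x y : Fin n) → x ≢ y → complete n x y ≡ true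
complete-edge x y x≢y with x F.≟ y
... | yes x≡y = ⊥-elim (x≢y x≡y)
... | no _    = refl

complete-oneCop : ∀ n → KCopsWin (complete (suc n)) 1
complete-oneCop n = (λ _ → F.zero) , win
  where
  win : ∀ r → CopsWin (complete (suc n)) (λ _ → F.zero) r
  win r with F.zero F.≟ r
  ... | yes 0≡r = caught (F.zero , 0≡r)
  ... | no 0≢r  = capture-adjacent (complete (suc n)) _ F.zero r (complete-edge F.zero r 0≢r)

fewer-than-one-lose : ∀ {n} (G : Edges (suc n)) k → k < 1 → ¬ KCopsWin G k
fewer-than-one-lose G zero    _             (cs , win) = noCops-lose G cs F.zero (win F.zero)
fewer-than-one-lose G (suc k) (s≤s ())

copNumber-one : ∀ {n} (G : Edges (suc n)) → KCopsWin G 1 → BridgeBurningCopNumber G 1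
copNumber-one G win = win , fewer-than-one-lose G

proposition2p1 : (∀ (n : ℕ) → 1 ≤ n → BridgeBurningCopNumber (complete n) 1)
    × (∀ (n : ℕ) → 3 ≤ n → BridgeBurningCopNumber (cycle n) 1)
    × (∀ (n : ℕ) → 1 ≤ n → n ≤ 5 → BridgeBurningCopNumber (path n) 1)
    × (∀ (n : ℕ) → 6 ≤ n → BridgeBurningCopNumber (path n) 2)
proposition2p1 = completeGraphs , cycles , shortPaths , longPaths
  where
  completeGraphs : ∀ n → 1 ≤ n → BridgeBurningCopNumber (complete n) 1
  completeGraphs (suc n) _ = copNumber-one _ (complete-oneCop n)
  cycles : ∀ n → 3 ≤ n → BridgeBurningCopNumber (cycle n) 1
  cycles (suc n) _ = copNumber-one _ (cycle-oneCop n)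
  shortPaths : ∀ n → 1 ≤ n → n ≤ 5 → BridgeBurningCopNumber (path n) 1
  shortPaths (suc n) _ n<5 = copNumber-one _ (path-oneCop-small n (≤-pred n<5))
  longPaths : ∀ n → 6 ≤ n → BridgeBurningCopNumber (path n) 2
  longPaths (suc n) 6≤n = path-twoCops n , fewer-than-two
    where
    fewer-than-two : ∀ k → k < 2 → ¬ KCopsWin (path (suc n)) k
    fewer-than-two zero             _ = fewer-than-one-lose _ zero (s≤s z≤n)
    fewer-than-two (suc zero)       _ = path-oneCop-loses n (≤-pred 6≤n)
    fewer-than-two (suc (suc k)) (s≤s (s≤s ()))
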